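{- Let $\diamond\in\{\wedge,\vee\}$, let $H_1,H_2$ be graphs with disjoint vertex sets, and let $h:G\to H_1\diamond H_2$ be a skew fibration. Then for $i=1,2$ the restriction $h|_{H_i}:h^{ -1}(H_i)\to H_i$ is a skew fibration.
   Context: A graph $(V,E)$: finite $V$, $E$ a set of two-element subsets of $V$; write $vw$. A homomorphism $h:G\to G'$ satisfies $vw\in E(G)\Rightarrow h(v)h(w)\in E(G')$. For disjoint vertex sets, union $G\vee G'=(V\cup V',E\cup E')$; join $G\wedge G'$ additionally contains all edges $vv'$, $v\in V$, $v'\in V'$. A homomorphism $h:G\to G'$ is a skew fibration if for every $v\in V(G)$ and every $w$ with $h(v)w\in E(G')$ there is $\hat w$ with $v\hat w\in E(G)$ and $h(\hat w)w\notin E(G')$. For $W\subseteq V(G)$, $G[W]$ is the induced subgraph. For an induced subgraph $H'$ of $H$ and $h:G\to H$, $h^{ -1}(H')=G[h^{ -1}(V(H'))]$ and the restriction $h|_{H'}:h^{ -1}(H')\to H'$ is $h|_{H'}(v)=h(v)$. -}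

module Defs where

open import Data.Nat using (ℕ)
open import Data.Fin using (Fin)
open import Data.Sum using (_⊎_; inj₁; inj₂)
open import Data.Product using (Σ; _×_; _,_; proj₁; proj₂)
open import Relation.Nullary using (¬_)
open import Relation.Binary.PropositionalEquality using (_≡_)
open import Function.Bundles using (_↔_)

-- A (simple, undirected) graph: a vertex type and a symmetric,
-- irreflexive edge relation  (E v w  means  vw ∈ E).
-- Finiteness of the vertex set is imposed separately (see Finite).
record Graph : Set₁ where
  field
    V      : Set
    E      : V → V → Set
    E-sym  : ∀ {v w} → E v w → E w v
    E-irr  : ∀ {v} → ¬ E v v
open Graph public

Finite : Graph → Set
Finite G = Σ ℕ λ n → V G ↔ Fin n

IsHom : (G G' : Graph) → (V G → V G') → Set
IsHom G G' h = ∀ {v w} → E G v w → E G' (h v) (h w)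

IsSkewFibration : (G G' : Graph) → (V G → V G') → Set
IsSkewFibration G G' h =
  IsHom G G' h ×
  (∀ (v : V G) (w : V G') → E G' (h v) w →
     Σ (V G) λ ŵ → E G v ŵ × ¬ E G' (h ŵ) w)

data UnionE (H₁ H₂ : Graph) : V H₁ ⊎ V H₂ → V H₁ ⊎ V H₂ → Set where
  e₁ : ∀ {a b} → E H₁ a b → UnionE H₁ H₂ (inj₁ a) (inj₁ b)
  e₂ : ∀ {a b} → E H₂ a b → UnionE H₁ H₂ (inj₂ a) (inj₂ b)

data JoinE (H₁ H₂ : Graph) : V H₁ ⊎ V H₂ → V H₁ ⊎ V H₂ → Set where
  e₁  : ∀ {a b} → E H₁ a b → JoinE H₁ H₂ (inj₁ a) (inj₁ b)
  e₂  : ∀ {a b} → E H₂ a b → JoinE H₁ H₂ (inj₂ a) (inj₂ b)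
  e₁₂ : ∀ {a b} → JoinE H₁ H₂ (inj₁ a) (inj₂ b)
  e₂₁ : ∀ {a b} → JoinE H₁ H₂ (inj₂ a) (inj₁ b)

-- H₁ ∨ H₂
UnionG : Graph → Graph → Graph
UnionG H₁ H₂ = record
  { V = V H₁ ⊎ V H₂ ; E = UnionE H₁ H₂ ; E-sym = sy ; E-irr = ir }
  where
  sy : ∀ {v w} → UnionE H₁ H₂ v w → UnionE H₁ H₂ w v
  sy (e₁ x) = e₁ (E-sym H₁ x)
  sy (e₂ x) = e₂ (E-sym H₂ x)
  ir : ∀ {v} → ¬ UnionE H₁ H₂ v v
  ir (e₁ x) = E-irr H₁ x
  ir (e₂ x) = E-irr H₂ x

-- H₁ ∧ H₂
JoinG : Graph → Graph → Graph
JoinG H₁ H₂ = record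
  { V = V H₁ ⊎ V H₂ ; E = JoinE H₁ H₂ ; E-sym = sy ; E-irr = ir }
  where
  sy : ∀ {v w} → JoinE H₁ H₂ v w → JoinE H₁ H₂ w v
  sy (e₁ x) = e₁ (E-sym H₁ x)
  sy (e₂ x) = e₂ (E-sym H₂ x)
  sy e₁₂ = e₂₁
  sy e₂₁ = e₁₂
  ir : ∀ {v} → ¬ JoinE H₁ H₂ v v
  ir (e₁ x) = E-irr H₁ x
  ir (e₂ x) = E-irr H₂ x

data Op : Set where
  join union : Op

OpE : Op → (H₁ H₂ : Graph) → V H₁ ⊎ V H₂ → V H₁ ⊎ V H₂ → Set
OpE join  H₁ H₂ = E (JoinG H₁ H₂)
OpE union H₁ H₂ = E (UnionG H₁ H₂)

-- H₁ ⋄ H₂ ; its vertex set is definitionally V H₁ ⊎ V H₂ for every ⋄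
_⋄[_]_ : Graph → Op → Graph → Graph
H₁ ⋄[ o ] H₂ = record
  { V = V H₁ ⊎ V H₂ ; E = OpE o H₁ H₂ ; E-sym = sy o ; E-irr = ir o }
  where
  sy : ∀ o {v w} → OpE o H₁ H₂ v w → OpE o H₁ H₂ w v
  sy join  = E-sym (JoinG H₁ H₂)
  sy union = E-sym (UnionG H₁ H₂)
  ir : ∀ o {v} → ¬ OpE o H₁ H₂ v v
  ir join  = E-irr (JoinG H₁ H₂)
  ir union = E-irr (UnionG H₁ H₂)

Induced : (G : Graph) → (V G → Set) → Graph
Induced G P = record
  { V = Σ (V G) P
  ; E = λ x y → E G (proj₁ x) (proj₁ y)
  ; E-sym = E-sym G
  ; E-irr = E-irr G }

-- Preimages  h⁻¹(H₁) = G[h⁻¹(V H₁)],  h⁻¹(H₂) = G[h⁻¹(V H₂)]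
-- (V H₁, V H₂ sit inside V H₁ ⊎ V H₂ via inj₁, inj₂)
preimage₁ : (G : Graph) (A B : Set) → (V G → A ⊎ B) → Graph
preimage₁ G A B h = Induced G (λ v → Σ A λ a → h v ≡ inj₁ a)

preimage₂ : (G : Graph) (A B : Set) → (V G → A ⊎ B) → Graph
preimage₂ G A B h = Induced G (λ v → Σ B λ b → h v ≡ inj₂ b)

restrict₁ : (G : Graph) (A B : Set) (h : V G → A ⊎ B) →
            V (preimage₁ G A B h) → A
restrict₁ G A B h (v , a , _) = a

restrict₂ : (G : Graph) (A B : Set) (h : V G → A ⊎ B) →
            V (preimage₂ G A B h) → B
restrict₂ G A B h (v , b , _) = b

-- A factor Hᵢ of H₁ ⋄ H₂ is an induced subgraph whose vertex set is a module: a vertex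
-- outside it is adjacent to all of it or to none of it. If v is mapped into a module M,
-- every witness ŵ provided by the skew fibration is adjacent to v, so h ŵ sees h v ∈ M
-- but not w ∈ M; hence h ŵ lies in M as well, and the restriction inherits the witness.

module Submission where

open import Defs
open import Data.Product using (Σ; _×_; _,_; proj₁; proj₂)
open import Data.Sum using (inj₁; inj₂)
open import Data.Empty using (⊥-elim)
open import Relation.Nullary using (¬_)
open import Relation.Binary.PropositionalEquality using (_≡_; refl; sym; subst; subst₂)

ReflectsEdges : (H' H : Graph) → (V H' → V H) → Set
ReflectsEdges H' H ι = ∀ {a b} → E H (ι a) (ι b) → E H' a b

-- Constructive reading of the module property: a vertex that sees one vertex of the
-- image and misses another lies in the image.
IsModule : (H' H : Graph) → (V H' → V H) → Set
IsModule H' H ι = ∀ {a w} x → E H (ι a) x → ¬ E H x (ι w) → Σ (V H') λ b → x ≡ ι b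

-- At ι = inj₁, inj₂ these are definitionally preimage₁/restrict₁ and preimage₂/restrict₂.
preimage : (G H' H : Graph) → (V H' → V H) → (V G → V H) → Graph
preimage G H' H ι h = Induced G (λ v → Σ (V H') λ a → h v ≡ ι a)

restrict : (G H' H : Graph) (ι : V H' → V H) (h : V G → V H) →
           V (preimage G H' H ι h) → V H'
restrict G H' H ι h v = proj₁ (proj₂ v)

restrict-isSkewFibration : (G H' H : Graph) (ι : V H' → V H) →
  IsHom H' H ι → ReflectsEdges H' H ι → IsModule H' H ι →
  (h : V G → V H) → IsSkewFibration G H h →
  IsSkewFibration (preimage G H' H ι h) H' (restrict G H' H ι h)
restrict-isSkewFibration G H' H ι ι-hom ι-reflects ι-module h (h-hom , h-skew) =
  (λ {v} {w} → restrict-hom {v} {w}) , restrict-skew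
  where
  restrict-hom : IsHom (preimage G H' H ι h) H' (restrict G H' H ι h)
  restrict-hom {v , a , hv≡ιa} {w , b , hw≡ιb} vw =
    ι-reflects (subst₂ (E H) hv≡ιa hw≡ιb (h-hom vw))

  restrict-skew : ∀ v w → E H' (restrict G H' H ι h v) w →
    Σ (V (preimage G H' H ι h)) λ ŵ → E G (proj₁ v) (proj₁ ŵ) × ¬ E H' (restrict G H' H ι h ŵ) w
  restrict-skew (v , a , hv≡ιa) w aw
    with h-skew v (ι w) (subst (λ x → E H x (ι w)) (sym hv≡ιa) (ι-hom aw))
  ... | ŵ , vŵ , hŵ≁ιw
    with ι-module (h ŵ) (subst (λ x → E H x (h ŵ)) hv≡ιa (h-hom vŵ)) hŵ≁ιw
  ... | b , hŵ≡ιb =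
    (ŵ , b , hŵ≡ιb) , vŵ , λ bw → hŵ≁ιw (subst (λ x → E H x (ι w)) (sym hŵ≡ιb) (ι-hom bw))

factor₁-isHom : ∀ ⋄ (H₁ H₂ : Graph) → IsHom H₁ (H₁ ⋄[ ⋄ ] H₂) inj₁
factor₁-isHom join  H₁ H₂ = e₁
factor₁-isHom union H₁ H₂ = e₁

factor₂-isHom : ∀ ⋄ (H₁ H₂ : Graph) → IsHom H₂ (H₁ ⋄[ ⋄ ] H₂) inj₂
factor₂-isHom join  H₁ H₂ = e₂
factor₂-isHom union H₁ H₂ = e₂

factor₁-reflectsEdges : ∀ ⋄ (H₁ H₂ : Graph) → ReflectsEdges H₁ (H₁ ⋄[ ⋄ ] H₂) inj₁
factor₁-reflectsEdges join  H₁ H₂ (e₁ ab) = ab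
factor₁-reflectsEdges union H₁ H₂ (e₁ ab) = ab

factor₂-reflectsEdges : ∀ ⋄ (H₁ H₂ : Graph) → ReflectsEdges H₂ (H₁ ⋄[ ⋄ ] H₂) inj₂
factor₂-reflectsEdges join  H₁ H₂ (e₂ ab) = ab
factor₂-reflectsEdges union H₁ H₂ (e₂ ab) = ab

factor₁-isModule : ∀ ⋄ (H₁ H₂ : Graph) → IsModule H₁ (H₁ ⋄[ ⋄ ] H₂) inj₁
factor₁-isModule ⋄     H₁ H₂ (inj₁ b) _  _  = b , refl
factor₁-isModule join  H₁ H₂ (inj₂ b) _  b≁w = ⊥-elim (b≁w e₂₁)
factor₁-isModule union H₁ H₂ (inj₂ b) ()

factor₂-isModule : ∀ ⋄ (H₁ H₂ : Graph) → IsModule H₂ (H₁ ⋄[ ⋄ ] H₂) inj₂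
factor₂-isModule ⋄     H₁ H₂ (inj₂ b) _  _  = b , refl
factor₂-isModule join  H₁ H₂ (inj₁ b) _  b≁w = ⊥-elim (b≁w e₁₂)
factor₂-isModule union H₁ H₂ (inj₁ b) ()

lemma2 : (⋄ : Op) (G H₁ H₂ : Graph) →
    Finite G → Finite H₁ → Finite H₂ →
    (h : V G → V (H₁ ⋄[ ⋄ ] H₂)) →
    IsSkewFibration G (H₁ ⋄[ ⋄ ] H₂) h →
    IsSkewFibration (preimage₁ G (V H₁) (V H₂) h) H₁ (restrict₁ G (V H₁) (V H₂) h)
    × IsSkewFibration (preimage₂ G (V H₁) (V H₂) h) H₂ (restrict₂ G (V H₁) (V H₂) h)
lemma2 ⋄ G H₁ H₂ _ _ _ h h-skew =
  restrict-isSkewFibration G H₁ (H₁ ⋄[ ⋄ ] H₂) inj₁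
    (factor₁-isHom ⋄ H₁ H₂) (factor₁-reflectsEdges ⋄ H₁ H₂) (factor₁-isModule ⋄ H₁ H₂) h h-skew ,
  restrict-isSkewFibration G H₂ (H₁ ⋄[ ⋄ ] H₂) inj₂
    (factor₂-isHom ⋄ H₁ H₂) (factor₂-reflectsEdges ⋄ H₁ H₂) (factor₂-isModule ⋄ H₁ H₂) h h-skew
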